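{- Let $G=(V,A)$ be a flow graph with start vertex $s$, let $T$ be a rooted tree with the parent property, and let $G'$ be the derived graph of $G$ with respect to $T$. A preorder of $T$ is low-high on $G$ if and only if it is low-high on $G'$.
   Context: A flow graph is a finite directed graph $G=(V,A)$ with start vertex $s$ such that every vertex is reachable from $s$; there are no arcs entering $s$. For a rooted tree $T$ with vertex set contained in $V$, $t(v)$ denotes the parent of $v$; ancestors and descendants include the vertex itself. $T$ has the parent property if for every arc $(v,w)\in A$, $t(w)$ is an ancestor of $v$ in $T$. For an arc $(v,w)\in A$, its derived arc is null if $w$ is an ancestor of $v$ in $T$, and otherwise is $(v',w)$, where $v'=v$ if $v=t(w)$, and otherwise $v'$ is the sibling of $w$ in $T$ that is an ancestor of $v$. The derived graph $G'$ has vertex set $V$ and arc set consisting of all non-null derived arcs of arcs in $A$. A preorder of $T$ is a total order of its vertices such that for every vertex $v$, the descendants of $v$ are ordered consecutively with $v$ first. A preorder of $T$ is low-high on a graph $H$ with vertex set $V$ and arc set $A_H$ if for every $v\neq s$, either $(t(v),v)\in A_H$, or there are two arcs $(u,v),(w,v)\in A_H$ with $u<v<w$ in the order and $w$ not a descendant of $v$ in $T$. -}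

module Defs where

open import Data.Nat using (ℕ; _<_; _≤_)
open import Data.Fin using (Fin)
open import Data.List using (List)
open import Data.List.Membership.Propositional using (_∈_)
open import Data.Product using (Σ; ∃; _×_; _,_)
open import Data.Sum using (_⊎_)
open import Function using (Injective)
open import Relation.Nullary using (¬_)
open import Relation.Binary.PropositionalEquality using (_≡_; _≢_)
open import Relation.Binary.Construct.Closure.ReflexiveTransitive using (Star)

Arcs : ℕ → Set
Arcs n = List (Fin n × Fin n)

ArcOf : ∀ {n} → Arcs n → Fin n → Fin n → Set
ArcOf A u v = (u , v) ∈ A

record IsFlowGraph {n : ℕ} (s : Fin n) (A : Arcs n) : Set where
  field
    noArcIntoStart : ∀ v → ¬ ((v , s) ∈ A)
    reachable      : ∀ v → Star (ArcOf A) s v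

iter : ∀ {n} → (Fin n → Fin n) → ℕ → Fin n → Fin n
iter t ℕ.zero v = v
iter t (ℕ.suc k) v = iter t k (t v)

-- A rooted tree on Fin n with root s given by a parent function t
-- (convention t s ≡ s; t v is the parent of v for v ≢ s),
-- acyclic: every vertex reaches the root by following parents.
record IsRootedTree {n : ℕ} (s : Fin n) (t : Fin n → Fin n) : Set where
  field
    rootFixed   : t s ≡ s
    reachesRoot : ∀ v → ∃ λ k → iter t k v ≡ s

Ancestor : ∀ {n} → (Fin n → Fin n) → Fin n → Fin n → Set
Ancestor t u v = ∃ λ k → iter t k v ≡ u

Descendant : ∀ {n} → (Fin n → Fin n) → Fin n → Fin n → Set
Descendant t w v = Ancestor t v w

ParentProperty : ∀ {n} → Arcs n → (Fin n → Fin n) → Set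
ParentProperty A t = ∀ v w → (v , w) ∈ A → Ancestor t (t w) v

-- (x , y) is the (non-null) derived arc of the arc (v , w) w.r.t. the tree (s, t)
DerivedArcOf : ∀ {n} → Fin n → (Fin n → Fin n) → (Fin n × Fin n) → Fin n → Fin n → Set
DerivedArcOf s t (v , w) x y =
  y ≡ w × ¬ Ancestor t w v ×
  ((v ≡ t w × x ≡ v) ⊎
   (v ≢ t w × (x ≢ s × t x ≡ t w × x ≢ w) × Ancestor t x v))

DerivedArc : ∀ {n} → Fin n → (Fin n → Fin n) → Arcs n → Fin n → Fin n → Set
DerivedArc s t A x y = ∃ λ a → a ∈ A × DerivedArcOf s t a x y

-- A total order on Fin n given by an injective position map; u < v iff pos u < pos v.
-- It is a preorder of the tree: descendants of v are consecutive, with v first.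
record IsPreorder {n : ℕ} (t : Fin n → Fin n) (pos : Fin n → ℕ) : Set where
  field
    injective   : Injective _≡_ _≡_ pos
    rootFirst   : ∀ v w → Descendant t w v → pos v ≤ pos w
    consecutive : ∀ v x w → Descendant t w v → pos v ≤ pos x → pos x ≤ pos w →
                  Descendant t x v

LowHigh : ∀ {n} → Fin n → (Fin n → Fin n) → (Fin n → ℕ) → (Fin n → Fin n → Set) → Set
LowHigh s t pos H =
  ∀ v → v ≢ s →
    H (t v) v ⊎
    (Σ _ λ u → Σ _ λ w → H u v × H w v × pos u < pos v × pos v < pos w × ¬ Descendant t w v)

module Submission where

-- Fix an arc (a, v) that is not a back arc (v is not an
-- ancestor of a); by the parent property t(v) is an ancestor of a, so the
-- arc has a derived arc (x, v), where x = a or x is the sibling of v whose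
-- subtree contains a.  In both cases x is an ancestor of a whose subtree
-- does not contain v, and since subtrees occupy consecutive intervals of a
-- preorder, a and x lie on the same side of v: a < v iff x < v and
-- v < a iff v < x.  Moreover the tree arc (t(v), v) is its own derived arc,
-- and a derived arc leaving t(v) can only come from the tree arc itself.
-- Hence each low/high witness for v in G is turned into one in G' by
-- replacing arcs with their derived arcs, and conversely each witness in G'
-- is turned into one in G by replacing derived arcs with their originals.

open import Defs
open import Data.Nat using (ℕ; zero; suc; _+_; _*_; _<_; _≤?_)
open import Data.Nat.Properties using (*-suc; ≤-<-trans; <-≤-trans; <⇒≤; ≰⇒>; <-irrefl)
open import Data.Fin using (Fin) renaming (_≟_ to _≟F_)
open import Data.Product using (∃; _×_; _,_)
open import Data.Sum using (_⊎_; inj₁; inj₂)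
open import Data.Empty using (⊥-elim)
open import Relation.Nullary using (¬_; yes; no)
open import Relation.Binary.PropositionalEquality
open import Data.List.Membership.Propositional using (_∈_)
open import Function.Bundles using (_⇔_; mk⇔; Equivalence)

open Equivalence using (to; from)

SubtreeAvoids : ∀ {n} → (Fin n → Fin n) → Fin n → Fin n → Fin n → Set
SubtreeAvoids t x a v = x ≡ a ⊎ ¬ Descendant t v x

module TreeFacts {n : ℕ} (s : Fin n) (t : Fin n → Fin n) (tree : IsRootedTree s t) where
  open IsRootedTree tree

  iter-+ : ∀ a b x → iter t (a + b) x ≡ iter t b (iter t a x)
  iter-+ zero    b x = refl
  iter-+ (suc a) b x = iter-+ a b (t x)

  iter-root : ∀ k → iter t k s ≡ s
  iter-root zero    = refl
  iter-root (suc k) = trans (cong (iter t k) rootFixed) (iter-root k)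

  iter-period : ∀ p x → iter t p x ≡ x → ∀ m → iter t (m * p) x ≡ x
  iter-period p x back zero    = refl
  iter-period p x back (suc m) = begin
    iter t (p + m * p) x          ≡⟨ iter-+ p (m * p) x ⟩
    iter t (m * p) (iter t p x)   ≡⟨ cong (iter t (m * p)) back ⟩
    iter t (m * p) x              ≡⟨ iter-period p x back m ⟩
    x                             ∎
    where open ≡-Reasoning

  -- Acyclicity: a non-root vertex is not an ancestor of its parent.
  -- (A cycle through x would keep x away from the root forever.)
  notAncestorOfParent : ∀ x → x ≢ s → ¬ Ancestor t x (t x)
  notAncestorOfParent x x≢s (k , back) with reachesRoot x
  ... | K , toRoot = x≢s (begin
    x                                   ≡⟨ sym (iter-period (suc k) x back K) ⟩
    iter t (K * suc k) x                ≡⟨ cong (λ m → iter t m x) (*-suc K k) ⟩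
    iter t (K + K * k) x                ≡⟨ iter-+ K (K * k) x ⟩
    iter t (K * k) (iter t K x)         ≡⟨ cong (iter t (K * k)) toRoot ⟩
    iter t (K * k) s                    ≡⟨ iter-root (K * k) ⟩
    s                                   ∎)
    where open ≡-Reasoning

  ancestor-trans : ∀ {x y z} → Ancestor t x y → Ancestor t y z → Ancestor t x z
  ancestor-trans {z = z} (k , y↑x) (j , z↑y) =
    j + k , trans (iter-+ j k z) (trans (cong (iter t k) z↑y) y↑x)

  ancestorOfParent : ∀ {x y} → Ancestor t x y → x ≢ y → Ancestor t x (t y)
  ancestorOfParent (zero  , y≡x) x≢y = ⊥-elim (x≢y (sym y≡x))
  ancestorOfParent (suc k , e)   _   = k , e

  childTowards : ∀ k y p → iter t k y ≡ p → y ≢ p →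
                 ∃ λ x → t x ≡ p × x ≢ p × Ancestor t x y
  childTowards zero    y p y≡p y≢p = ⊥-elim (y≢p y≡p)
  childTowards (suc k) y p up  y≢p with t y ≟F p
  ... | yes ty≡p = y , ty≡p , y≢p , (0 , refl)
  ... | no  ty≢p with childTowards k (t y) p up ty≢p
  ...   | x , tx≡p , x≢p , (j , up′) = x , tx≡p , x≢p , (suc j , up′)

  siblingNotAncestor : ∀ {x v} → x ≢ s → t x ≡ t v → x ≢ v → ¬ Ancestor t x v
  siblingNotAncestor {x} x≢s tx≡tv x≢v x↑v =
    notAncestorOfParent x x≢s (subst (Ancestor t x) (sym tx≡tv) (ancestorOfParent x↑v x≢v))

module PreorderFacts {n : ℕ} (t : Fin n → Fin n) (pos : Fin n → ℕ)
                     (preorder : IsPreorder t pos) where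
  open IsPreorder preorder

  earlierNotDescendant : ∀ {u v} → pos u < pos v → ¬ Descendant t u v
  earlierNotDescendant u<v u↓v = <-irrefl refl (<-≤-trans u<v (rootFirst _ _ u↓v))

  -- The subtree of x is an interval starting at x; if v lies outside it,
  -- then v is after the whole subtree as soon as it is after x ...
  subtreeBefore : ∀ {x a v} → Descendant t a x → ¬ Descendant t v x →
                  pos x < pos v → pos a < pos v
  subtreeBefore {x} {a} {v} a↓x v↓̸x x<v with pos v ≤? pos a
  ... | yes v≤a = ⊥-elim (v↓̸x (consecutive x v a a↓x (<⇒≤ x<v) v≤a))
  ... | no  v≰a = ≰⇒> v≰a

  subtreeAfter : ∀ {x a v} → Descendant t a x → ¬ Descendant t v x →
                 pos v < pos a → pos v < pos x
  subtreeAfter {x} {a} {v} a↓x v↓̸x v<a with pos x ≤? pos v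
  ... | yes x≤v = ⊥-elim (v↓̸x (consecutive x v a a↓x x≤v (<⇒≤ v<a)))
  ... | no  x≰v = ≰⇒> x≰v

  sameSideBefore : ∀ {x a v} → Descendant t a x → SubtreeAvoids t x a v →
                   pos a < pos v ⇔ pos x < pos v
  sameSideBefore {x} {a} {v} a↓x avoids = mk⇔ (≤-<-trans (rootFirst _ _ a↓x)) (back avoids)
    where
    back : SubtreeAvoids t x a v → pos x < pos v → pos a < pos v
    back (inj₁ refl) x<v = x<v
    back (inj₂ v↓̸x) x<v = subtreeBefore a↓x v↓̸x x<v

  sameSideAfter : ∀ {x a v} → Descendant t a x → SubtreeAvoids t x a v →
                  pos v < pos a ⇔ pos v < pos x
  sameSideAfter {x} {a} {v} a↓x avoids = mk⇔ (forth avoids) (λ v<x → <-≤-trans v<x (rootFirst _ _ a↓x))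
    where
    forth : SubtreeAvoids t x a v → pos v < pos a → pos v < pos x
    forth (inj₁ refl) v<a = v<a
    forth (inj₂ v↓̸x) v<a = subtreeAfter a↓x v↓̸x v<a

module DerivedArcFacts {n : ℕ} (s : Fin n) (t : Fin n → Fin n) (tree : IsRootedTree s t) where
  open IsRootedTree tree
  open TreeFacts s t tree

  derivedArcExists : ∀ a v → Ancestor t (t v) a → ¬ Ancestor t v a →
                     ∃ λ x → DerivedArcOf s t (a , v) x v
  derivedArcExists a v (k , up) v↑̸a with a ≟F t v
  ... | yes a≡tv = a , refl , v↑̸a , inj₁ (a≡tv , refl)
  ... | no  a≢tv with childTowards k a (t v) up a≢tv
  ...   | x , tx≡tv , x≢tv , x↑a = x , refl , v↑̸a , inj₂ (a≢tv , (x≢s , tx≡tv , x≢v) , x↑a)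
    where
    x≢s : x ≢ s
    x≢s refl = x≢tv (trans (sym rootFixed) tx≡tv)
    x≢v : x ≢ v
    x≢v refl = v↑̸a x↑a

  -- The source of a derived arc is an ancestor of the source of the arc,
  -- and either equals it or is a sibling of v, whose subtree avoids v.
  derivedSourceAncestor : ∀ {a v x} → DerivedArcOf s t (a , v) x v → Ancestor t x a
  derivedSourceAncestor (_ , _ , inj₁ (_ , refl))  = 0 , refl
  derivedSourceAncestor (_ , _ , inj₂ (_ , _ , x↑a)) = x↑a

  derivedSourceAvoids : ∀ {a v x} → DerivedArcOf s t (a , v) x v → SubtreeAvoids t x a v
  derivedSourceAvoids (_ , _ , inj₁ (_ , x≡a)) = inj₁ x≡a
  derivedSourceAvoids (_ , _ , inj₂ (_ , (x≢s , tx≡tv , x≢v) , _)) =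
    inj₂ (siblingNotAncestor x≢s tx≡tv x≢v)

  treeArcDerived : ∀ v → v ≢ s → DerivedArcOf s t (t v , v) (t v) v
  treeArcDerived v v≢s = refl , notAncestorOfParent v v≢s , inj₁ (refl , refl)

  derivedFromParent : ∀ {a v} → DerivedArcOf s t (a , v) (t v) v → a ≡ t v
  derivedFromParent (_ , _ , inj₁ (a≡tv , _)) = a≡tv
  derivedFromParent {v = v} (_ , _ , inj₂ (_ , (tv≢s , ttv≡tv , _) , _)) =
    ⊥-elim (notAncestorOfParent (t v) tv≢s (0 , ttv≡tv))

module LowHighTransfer {n : ℕ} (s : Fin n) (A : Arcs n)
                       (t : Fin n → Fin n) (tree : IsRootedTree s t) (parent : ParentProperty A t)
                       (pos : Fin n → ℕ) (preorder : IsPreorder t pos) where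
  open TreeFacts s t tree
  open PreorderFacts t pos preorder
  open DerivedArcFacts s t tree

  toDerived : LowHigh s t pos (ArcOf A) → LowHigh s t pos (DerivedArc s t A)
  toDerived lowHigh v v≢s with lowHigh v v≢s
  ... | inj₁ tv→v = inj₁ (_ , tv→v , treeArcDerived v v≢s)
  ... | inj₂ (u , w , u→v , w→v , u<v , v<w , w↓̸v)
    with derivedArcExists u v (parent u v u→v) (earlierNotDescendant u<v)
       | derivedArcExists w v (parent w v w→v) w↓̸v
  ...   | u′ , du | w′ , dw =
    inj₂ (u′ , w′ , (_ , u→v , du) , (_ , w→v , dw) ,
          to (sameSideBefore (derivedSourceAncestor du) (derivedSourceAvoids du)) u<v ,
          to (sameSideAfter  (derivedSourceAncestor dw) (derivedSourceAvoids dw)) v<w ,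
          λ w′↓v → w↓̸v (ancestor-trans w′↓v (derivedSourceAncestor dw)))

  fromDerived : LowHigh s t pos (DerivedArc s t A) → LowHigh s t pos (ArcOf A)
  fromDerived lowHigh v v≢s with lowHigh v v≢s
  ... | inj₁ ((a , _) , a→v , d@(refl , _)) =
    inj₁ (subst (λ z → (z , v) ∈ A) (derivedFromParent d) a→v)
  ... | inj₂ (u , w , ((a , _) , a→v , du@(refl , _)) , ((b , _) , b→v , dw@(refl , b↓̸v , _)) ,
              u<v , v<w , _) =
    inj₂ (a , b , a→v , b→v ,
          from (sameSideBefore (derivedSourceAncestor du) (derivedSourceAvoids du)) u<v ,
          from (sameSideAfter  (derivedSourceAncestor dw) (derivedSourceAvoids dw)) v<w ,
          b↓̸v)

lemma17 : (n : ℕ) (s : Fin n) (A : Arcs n) → IsFlowGraph s A →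
          (t : Fin n → Fin n) → IsRootedTree s t → ParentProperty A t →
          (pos : Fin n → ℕ) → IsPreorder t pos →
          LowHigh s t pos (ArcOf A) ⇔ LowHigh s t pos (DerivedArc s t A)
lemma17 n s A _ t tree parent pos preorder = mk⇔ toDerived fromDerived
  where open LowHighTransfer s A t tree parent pos preorder
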